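{- Let $K=(AP,S,R,s_0,I)$ and $K'$ be Kripke structures such that $K'$ is $x$-bisimilar to $K$ via a relation $\rho$, and let $\varphi$ be a $\mathrm{CTL}^*$ formula not containing $x$. Then $K'\models\varphi$ if and only if $K'\models \mathrm{Prop}(\varphi,K)$, for any propositional simplification $\mathrm{Prop}(\varphi,K)$ of $\varphi$ with respect to $K$.
   Context: A Kripke structure $K=(AP,S,R,s_0,I)$ consists of atomic propositions $AP$, a finite set $S$ of states, a total transition relation $R\subseteq S\times S$, an initial state $s_0$ and labeling $I:S\to 2^{AP}$; $\mathrm{CTL}^*$ has the standard syntax and semantics and $K\models\varphi$ means $K,s_0\models\varphi$. $K'$ is $x$-bisimilar to $K$ (with $x\notin AP$) iff $K'$ has atomic propositions $AP\cup\{x\}$ and there is a relation $\rho\subseteq S\times S'$ with $\rho(s_0,s'_0)$ such that related states agree on $AP$ and each transition from one of two related states is matched by a transition of the other to a related state (in both directions). A propositional simplification $\mathrm{Prop}(\varphi,K)$ of $\varphi$ with respect to $K$ is a formula obtained from $\varphi$ by replacing some state subformulas $\chi$ of $\varphi$ with a propositional formula over $AP$ encoding the set $\|\chi\|^K=\{s\in S\mid K,s\models\chi\}$, i.e., a propositional formula true at exactly the states of $K$ in $\|\chi\|^K$. -}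

module Defs where

open import Data.Nat using (ℕ; zero; suc; _+_; _<_)
open import Data.Fin using (Fin)
open import Data.Bool using (Bool; true)
open import Data.Maybe using (Maybe; just; nothing)
open import Data.Product using (Σ; ∃; _×_; _,_)
open import Data.Empty using (⊥)
open import Data.Unit using (⊤)
open import Relation.Binary.PropositionalEquality using (_≡_)
open import Function.Bundles using (_⇔_)

record Kripke (A : Set) : Set where
  field
    n     : ℕ
    R     : Fin n → Fin n → Bool
    total : ∀ s → ∃ λ t → R s t ≡ true
    s₀    : Fin n
    I     : Fin n → A → Bool

State : ∀ {A} → Kripke A → Set
State K = Fin (Kripke.n K)

mutual
  data SF (A : Set) : Set where
    atom : A → SF A
    tt   : SF A
    ¬ₛ_  : SF A → SF A
    _∧ₛ_ : SF A → SF A → SF A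
    E    : PF A → SF A

  data PF (A : Set) : Set where
    st   : SF A → PF A
    ¬ₚ_  : PF A → PF A
    _∧ₚ_ : PF A → PF A → PF A
    X    : PF A → PF A
    _U_  : PF A → PF A → PF A

-- A path formula "A ψ" is definable as ¬ E ¬ ψ; disjunction etc. are derived.

-- Renaming of atomic propositions (used to view a formula over AP as a
-- formula over AP ∪ {x}).

mutual
  mapS : ∀ {A B : Set} → (A → B) → SF A → SF B
  mapS f (atom p)  = atom (f p)
  mapS f tt        = tt
  mapS f (¬ₛ φ)    = ¬ₛ mapS f φ
  mapS f (φ ∧ₛ ψ)  = mapS f φ ∧ₛ mapS f ψ
  mapS f (E ψ)     = E (mapP f ψ)

  mapP : ∀ {A B : Set} → (A → B) → PF A → PF B
  mapP f (st φ)    = st (mapS f φ)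
  mapP f (¬ₚ ψ)    = ¬ₚ mapP f ψ
  mapP f (ψ ∧ₚ χ)  = mapP f ψ ∧ₚ mapP f χ
  mapP f (X ψ)     = X (mapP f ψ)
  mapP f (ψ U χ)   = mapP f ψ U mapP f χ

module _ {A : Set} (K : Kripke A) where
  open Kripke K

  IsPath : (ℕ → Fin n) → Set
  IsPath π = ∀ i → R (π i) (π (suc i)) ≡ true

  suffix : (ℕ → Fin n) → ℕ → (ℕ → Fin n)
  suffix π k i = π (k + i)

  mutual
    _⊨ₛ_ : Fin n → SF A → Set
    s ⊨ₛ atom p   = I s p ≡ true
    s ⊨ₛ tt       = ⊤
    s ⊨ₛ (¬ₛ φ)   = s ⊨ₛ φ → ⊥
    s ⊨ₛ (φ ∧ₛ ψ) = (s ⊨ₛ φ) × (s ⊨ₛ ψ)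
    s ⊨ₛ E ψ      = Σ (ℕ → Fin n) λ π → (π 0 ≡ s) × IsPath π × (π ⊨ₚ ψ)

    _⊨ₚ_ : (ℕ → Fin n) → PF A → Set
    π ⊨ₚ st φ     = π 0 ⊨ₛ φ
    π ⊨ₚ (¬ₚ ψ)   = π ⊨ₚ ψ → ⊥
    π ⊨ₚ (ψ ∧ₚ χ) = (π ⊨ₚ ψ) × (π ⊨ₚ χ)
    π ⊨ₚ X ψ      = suffix π 1 ⊨ₚ ψ
    π ⊨ₚ (ψ U χ)  = Σ ℕ λ k → (suffix π k ⊨ₚ χ) × (∀ j → j < k → suffix π j ⊨ₚ ψ)

  Models : SF A → Set
  Models φ = s₀ ⊨ₛ φ

-- x-bisimilarity.  K' has atoms AP ∪ {x}, modelled as Maybe AP with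
-- x = nothing and p ∈ AP as just p.

record XBisim {AP : Set} (K : Kripke AP) (K' : Kripke (Maybe AP)) : Set₁ where
  private
    module K  = Kripke K
    module K' = Kripke K'
  field
    ρ     : Fin K.n → Fin K'.n → Set
    init  : ρ K.s₀ K'.s₀
    label : ∀ {s s'} → ρ s s' → ∀ (p : AP) → K.I s p ≡ K'.I s' (just p)
    forth : ∀ {s s'} → ρ s s' → ∀ t → K.R s t ≡ true →
              ∃ λ t' → (K'.R s' t' ≡ true) × ρ t t'
    back  : ∀ {s s'} → ρ s s' → ∀ t' → K'.R s' t' ≡ true →
              ∃ λ t → (K.R s t ≡ true) × ρ t t'

data IsPropositional {A : Set} : SF A → Set where
  atom : ∀ p → IsPropositional (atom p)
  tt   : IsPropositional tt
  ¬ₛ_  : ∀ {φ} → IsPropositional φ → IsPropositional (¬ₛ φ)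
  _∧ₛ_ : ∀ {φ ψ} → IsPropositional φ → IsPropositional ψ → IsPropositional (φ ∧ₛ ψ)

Encodes : ∀ {A} (K : Kripke A) → SF A → SF A → Set
Encodes K β χ = ∀ (s : State K) → (_⊨ₛ_ K s β) ⇔ (_⊨ₛ_ K s χ)

-- SimpS K φ φ' : φ' is obtained from φ by replacing some (non-nested)
-- occurrences of state subformulas χ by propositional formulas over AP
-- encoding ‖χ‖^K.
mutual
  data SimpS {A : Set} (K : Kripke A) : SF A → SF A → Set where
    replace : ∀ {χ β} → IsPropositional β → Encodes K β χ → SimpS K χ β
    atom    : ∀ p → SimpS K (atom p) (atom p)
    tt      : SimpS K tt tt
    ¬ₛ_     : ∀ {φ φ'} → SimpS K φ φ' → SimpS K (¬ₛ φ) (¬ₛ φ')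
    _∧ₛ_    : ∀ {φ φ' ψ ψ'} → SimpS K φ φ' → SimpS K ψ ψ' → SimpS K (φ ∧ₛ ψ) (φ' ∧ₛ ψ')
    E       : ∀ {ψ ψ'} → SimpP K ψ ψ' → SimpS K (E ψ) (E ψ')

  data SimpP {A : Set} (K : Kripke A) : PF A → PF A → Set where
    st   : ∀ {φ φ'} → SimpS K φ φ' → SimpP K (st φ) (st φ')
    ¬ₚ_  : ∀ {ψ ψ'} → SimpP K ψ ψ' → SimpP K (¬ₚ ψ) (¬ₚ ψ')
    _∧ₚ_ : ∀ {ψ ψ' χ χ'} → SimpP K ψ ψ' → SimpP K χ χ' → SimpP K (ψ ∧ₚ χ) (ψ' ∧ₚ χ')
    X    : ∀ {ψ ψ'} → SimpP K ψ ψ' → SimpP K (X ψ) (X ψ')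
    _U_  : ∀ {ψ ψ' χ χ'} → SimpP K ψ ψ' → SimpP K χ χ' → SimpP K (ψ U χ) (ψ' U χ')

module Submission where

-- Proof idea.  Write ρ for the x-bisimulation between K and K', and read a
-- formula over AP as a formula over AP ∪ {x} via  mapS just.
--
-- 1. Path lifting: along a relation with the "forth" property every path
--    of one structure is shadowed, state by state, by a related path of
--    the other.  Applied to ρ and to its converse this gives both
--    directions of the E-clause below.
-- 2. Bisimulation invariance: related states satisfy the same state
--    formulas over AP, and pointwise related paths the same path formulas.
-- 3. Simplification lemma: call a state of K' covered if it is ρ-related
--    to some state of K.  At a covered state, φ and any simplification φ'
--    agree in K'.  The only non-congruence case is a replacement of χ by an
--    encoding β of ‖χ‖^K, settled by transporting  χ ⇔ β  from K to K'
--    with invariance; for E one uses that paths from covered states stay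
--    covered, which is path lifting along the converse of ρ.
-- Since the initial state of K' is covered by s₀, the theorem follows.

open import Defs
open import Data.Fin using (Fin)
open import Data.Maybe using (Maybe; just)
open import Data.Nat using (ℕ; zero; suc; _+_; _<_)
open import Data.Product using (Σ; ∃; _×_; _,_; proj₁; proj₂)
open import Data.Product.Function.NonDependent.Propositional using (_×-⇔_)
open import Data.Bool using (true)
open import Function.Bundles using (_⇔_; mk⇔; Equivalence)
open import Function.Properties.Equivalence using () renaming (refl to ⇔-refl; sym to ⇔-sym; trans to ⇔-trans)
open import Function.Related.TypeIsomorphisms using (¬-cong-⇔)
open import Relation.Binary.PropositionalEquality using (_≡_; refl; sym; subst)

open Equivalence using (to; from)

until-cong : {P P' Q Q' : ℕ → Set} →
             (∀ k → P k ⇔ P' k) → (∀ k → Q k ⇔ Q' k) →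
             (Σ ℕ λ k → Q k × (∀ j → j < k → P j)) ⇔
             (Σ ℕ λ k → Q' k × (∀ j → j < k → P' j))
until-cong P⇔P' Q⇔Q' = mk⇔
  (λ { (k , q , before) → k , to (Q⇔Q' k) q , λ j j<k → to (P⇔P' j) (before j j<k) })
  (λ { (k , q , before) → k , from (Q⇔Q' k) q , λ j j<k → from (P⇔P' j) (before j j<k) })

module PathLifting {A B : Set} (K₁ : Kripke A) (K₂ : Kripke B)
                   (ρ : State K₁ → State K₂ → Set)
                   (forth : ∀ {s s'} → ρ s s' → ∀ t → Kripke.R K₁ s t ≡ true →
                            ∃ λ t' → (Kripke.R K₂ s' t' ≡ true) × ρ t t')
                   where

  Shadows : (ℕ → State K₁) → (ℕ → State K₂) → Set
  Shadows π π' = ∀ i → ρ (π i) (π' i)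

  liftPath : ∀ π → IsPath K₁ π → ∀ {s'} → ρ (π 0) s' →
             Σ (ℕ → State K₂) λ π' → (π' 0 ≡ s') × IsPath K₂ π' × Shadows π π'
  liftPath π path {s'} related = (λ i → proj₁ (lifted i)) , refl , step , λ i → proj₂ (lifted i)
    where
    lifted : ∀ i → Σ (State K₂) (ρ (π i))
    lifted zero    = s' , related
    lifted (suc i) with forth (proj₂ (lifted i)) (π (suc i)) (path i)
    ... | t' , _ , ρt = t' , ρt

    step : IsPath K₂ (λ i → proj₁ (lifted i))
    step i with forth (proj₂ (lifted i)) (π (suc i)) (path i)
    ... | _ , edge , _ = edge

module _ {m : ℕ} {K : Kripke (Fin m)} {K' : Kripke (Maybe (Fin m))} (bisim : XBisim K K') where
  open XBisim bisim

  private
    module Forward  = PathLifting K K' ρ forth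
    module Backward = PathLifting K' K (λ s' s → ρ s s') back

  mutual
    invariantS : ∀ φ {s s'} → ρ s s' → _⊨ₛ_ K s φ ⇔ _⊨ₛ_ K' s' (mapS just φ)
    invariantS (atom p) ρss' = mk⇔ (subst (_≡ true) (label ρss' p))
                                    (subst (_≡ true) (sym (label ρss' p)))
    invariantS tt       _    = ⇔-refl
    invariantS (¬ₛ φ)   ρss' = ¬-cong-⇔ (invariantS φ ρss')
    invariantS (φ ∧ₛ ψ) ρss' = invariantS φ ρss' ×-⇔ invariantS ψ ρss'
    invariantS (E ψ) {s} {s'} ρss' = mk⇔ forward backward
      where
      forward : _⊨ₛ_ K s (E ψ) → _⊨ₛ_ K' s' (mapS just (E ψ))
      forward (π , refl , path , sat) with Forward.liftPath π path ρss'
      ... | π' , start , path' , shadow = π' , start , path' , to (invariantP ψ shadow) sat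

      backward : _⊨ₛ_ K' s' (mapS just (E ψ)) → _⊨ₛ_ K s (E ψ)
      backward (π' , refl , path' , sat) with Backward.liftPath π' path' ρss'
      ... | π , start , path , shadow = π , start , path , from (invariantP ψ shadow) sat

    invariantP : ∀ ψ {π π'} → Forward.Shadows π π' → _⊨ₚ_ K π ψ ⇔ _⊨ₚ_ K' π' (mapP just ψ)
    invariantP (st φ)   shadow = invariantS φ (shadow 0)
    invariantP (¬ₚ ψ)   shadow = ¬-cong-⇔ (invariantP ψ shadow)
    invariantP (ψ ∧ₚ χ) shadow = invariantP ψ shadow ×-⇔ invariantP χ shadow
    invariantP (X ψ)    shadow = invariantP ψ (λ i → shadow (1 + i))
    invariantP (ψ U χ)  shadow = until-cong (λ k → invariantP ψ (λ i → shadow (k + i)))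
                                            (λ k → invariantP χ (λ i → shadow (k + i)))

  Covered : State K' → Set
  Covered s' = ∃ λ s → ρ s s'

  -- Every path of K' leaving a covered state visits only covered states
  -- (lift it back to K along the converse of ρ).
  coveredPath : ∀ π' → IsPath K' π' → Covered (π' 0) → ∀ i → Covered (π' i)
  coveredPath π' path' (s , ρsπ'₀) with Backward.liftPath π' path' ρsπ'₀
  ... | π , _ , _ , shadow = λ i → π i , shadow i

  mutual
    simplifyS : ∀ {φ φ'} → SimpS K φ φ' → ∀ {s'} → Covered s' →
                _⊨ₛ_ K' s' (mapS just φ) ⇔ _⊨ₛ_ K' s' (mapS just φ')
    simplifyS (replace {χ} {β} _ β-encodes-χ) (s , ρss') =
      ⇔-trans (⇔-sym (invariantS χ ρss')) (⇔-trans (⇔-sym (β-encodes-χ s)) (invariantS β ρss'))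
    simplifyS (atom p) _ = ⇔-refl
    simplifyS tt       _ = ⇔-refl
    simplifyS (¬ₛ d)   covered = ¬-cong-⇔ (simplifyS d covered)
    simplifyS (d ∧ₛ e) covered = simplifyS d covered ×-⇔ simplifyS e covered
    simplifyS (E {ψ} {ψ'} d) {s'} covered = mk⇔ forward backward
      where
      forward : _⊨ₛ_ K' s' (mapS just (E ψ)) → _⊨ₛ_ K' s' (mapS just (E ψ'))
      forward (π' , refl , path' , sat) =
        π' , refl , path' , to (simplifyP d π' (coveredPath π' path' covered)) sat

      backward : _⊨ₛ_ K' s' (mapS just (E ψ')) → _⊨ₛ_ K' s' (mapS just (E ψ))
      backward (π' , refl , path' , sat) =
        π' , refl , path' , from (simplifyP d π' (coveredPath π' path' covered)) sat

    simplifyP : ∀ {ψ ψ'} → SimpP K ψ ψ' → ∀ π' → (∀ i → Covered (π' i)) →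
                _⊨ₚ_ K' π' (mapP just ψ) ⇔ _⊨ₚ_ K' π' (mapP just ψ')
    simplifyP (st d)   π' covered = simplifyS d (covered 0)
    simplifyP (¬ₚ d)   π' covered = ¬-cong-⇔ (simplifyP d π' covered)
    simplifyP (d ∧ₚ e) π' covered = simplifyP d π' covered ×-⇔ simplifyP e π' covered
    simplifyP (X d)    π' covered = simplifyP d (suffix K' π' 1) (λ i → covered (1 + i))
    simplifyP (d U e)  π' covered =
      until-cong (λ k → simplifyP d (suffix K' π' k) (λ i → covered (k + i)))
                 (λ k → simplifyP e (suffix K' π' k) (λ i → covered (k + i)))

theorem4p10 : ∀ {m : ℕ} (K : Kripke (Fin m)) (K' : Kripke (Maybe (Fin m)))
              → XBisim K K'
              → (φ φ' : SF (Fin m)) → SimpS K φ φ'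
              → Models K' (mapS just φ) ⇔ Models K' (mapS just φ')
theorem4p10 K K' bisim φ φ' simplification =
  simplifyS bisim simplification (Kripke.s₀ K , XBisim.init bisim)
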